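{- Let $r$ be a positive integer. For every $k\ge1$, the digraph $G_k$ (constructed with parameter $r$) has a $p,q$ good decomposition.
   Context: CGK construction with parameter $r$: $G_1$ has vertices $p=w_0,w_1,\dots,w_{r+1}=q$ and edges $(w_i,w_{i+1}),(w_{i+1},w_i)$ for $0\le i\le r$; its source is $p$ and sink is $q$. For $k\ge2$, $G_k$ consists of $r$ disjoint copies $G_{k-1}^{(1)},\dots,G_{k-1}^{(r)}$ of $G_{k-1}$, where $u_i,v_i$ denote the source and sink of the $i$-th copy, plus new vertices $p,q$ (source and sink of $G_k$) and new edges $(p,u_1),(u_1,u_2),\dots,(u_{r-1},u_r),(u_r,q)$ and $(q,v_r),(v_r,v_{r-1}),\dots,(v_2,v_1),(v_1,p)$; let $E_k$ be the set of these new edges. External/internal edges: all edges of $G_1$ are external. For $k\ge2$, let $E^{(i)}_{k-1}$ be the set of edges of $G^{(i)}_{k-1}$ that do not belong to any of the $r$ copies of $G_{k-2}$ from which $G^{(i)}_{k-1}$ is built (for $k=2$ this is all of $E(G_1^{(i)})$, as $G_0$ is a single vertex); the external edge set of $G_k$ is $E_k\cup\bigcup_{i=1}^r E^{(i)}_{k-1}$, and the other edges of $G_k$ are internal. $p,q$ good decomposition: the edge set of $G_k$ is partitioned into dicycles $C_1,\dots,C_N$ such that for each $i$, either (1) $C_i$ consists of external edges and $G_k-E(C_i)$ has exactly two strongly connected components, one containing the source $p$ and the other containing the sink $q$; or (2) $C_i$ consists of internal edges and $G_k-E(C_i)$ is strongly connected. -}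

module Defs where

open import Data.Nat using (ℕ; zero; suc; _≤_)
open import Data.Fin using (Fin; toℕ; fromℕ; inject₁) renaming (zero to fzero; suc to fsuc)
open import Data.Product using (Σ; _×_; _,_)
open import Data.Sum using (_⊎_)
open import Data.Empty using (⊥)
open import Data.Unit using (⊤)
open import Data.List using (List; []; _∷_; zip; _++_; [_])
open import Data.List.Membership.Propositional using (_∈_)
open import Data.List.Relation.Unary.All using (All)
open import Data.List.Relation.Unary.Unique.Propositional using (Unique)
open import Relation.Nullary using (¬_)
open import Relation.Binary.PropositionalEquality using (_≡_; _≢_)

-- Vertices of G_k (built with parameter r).
--   level 1 : w_0 , … , w_{r+1}   (w 0 = p, w (r+1) = q)
--   level k+2 : src (= p), snk (= q), and  cp i x  = vertex x of the
--               i-th copy G_{k+1}^{(i)}  (i : Fin r, 0-based).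
-- There are no vertices at level 0 (G_0 is never used as a graph here).

data Vtx (r : ℕ) : ℕ → Set where
  w   : Fin (suc (suc r)) → Vtx r 1
  src : ∀ {k} → Vtx r (suc (suc k))
  snk : ∀ {k} → Vtx r (suc (suc k))
  cp  : ∀ {k} → Fin r → Vtx r (suc k) → Vtx r (suc (suc k))

source : ∀ {r} k → Vtx r (suc k)
source zero    = w fzero
source (suc k) = src

sink : ∀ {r} k → Vtx r (suc k)
sink {r} zero = w (fromℕ (suc r))
sink (suc k)  = snk

-- Arcs of G_k.  (Copy indices are 0-based: copy i is G^{(i+1)} of the paper.)

data Edge {r : ℕ} : ∀ {k} → Vtx r k → Vtx r k → Set where
  fwd : (i : Fin (suc r)) → Edge (w (inject₁ i)) (w (fsuc i))
  bwd : (i : Fin (suc r)) → Edge (w (fsuc i)) (w (inject₁ i))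
  p→u : ∀ {k} (i : Fin r) → toℕ i ≡ 0 →
        Edge {k = suc (suc k)} src (cp i (source k))
  u→u : ∀ {k} (i j : Fin r) → suc (toℕ i) ≡ toℕ j →
        Edge {k = suc (suc k)} (cp i (source k)) (cp j (source k))
  u→q : ∀ {k} (i : Fin r) → suc (toℕ i) ≡ r →
        Edge {k = suc (suc k)} (cp i (source k)) snk
  q→v : ∀ {k} (i : Fin r) → suc (toℕ i) ≡ r →
        Edge {k = suc (suc k)} snk (cp i (sink k))
  v→v : ∀ {k} (i j : Fin r) → suc (toℕ i) ≡ toℕ j →
        Edge {k = suc (suc k)} (cp j (sink k)) (cp i (sink k))
  v→p : ∀ {k} (i : Fin r) → toℕ i ≡ 0 →
        Edge {k = suc (suc k)} (cp i (sink k)) src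
  lift : ∀ {k} (i : Fin r) {u v : Vtx r (suc k)} →
         Edge u v → Edge (cp i u) (cp i v)

-- "Top-level" arcs of a graph G_k: all of E(G_1) for k = 1, and E_k for k ≥ 2
-- (i.e. arcs not belonging to any copy of G_{k-1}).
Top : ∀ {r k} {u v : Vtx r k} → Edge u v → Set
Top (lift _ _) = ⊥
Top _          = ⊤

-- External arcs of G_k: all arcs for k = 1; for k ≥ 2 the arcs of E_k
-- together with the top-level arcs E^{(i)}_{k-1} of each copy.
External : ∀ {r k} {u v : Vtx r k} → Edge u v → Set
External (lift _ e) = Top e
External _          = ⊤

Internal : ∀ {r k} {u v : Vtx r k} → Edge u v → Set
Internal e = ¬ External e

-- Dicycles: a nonempty list of pairwise distinct vertices v_0 … v_{m-1}
-- with arcs (v_0,v_1), …, (v_{m-1},v_0).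

cyclePairs : ∀ {A : Set} → List A → List (A × A)
cyclePairs []       = []
cyclePairs (x ∷ xs) = zip (x ∷ xs) (xs ++ [ x ])

record Dicycle (r k : ℕ) : Set where
  field
    verts    : List (Vtx r k)
    nonempty : verts ≢ []
    distinct : Unique verts
    arcs     : All (λ { (u , v) → Edge u v }) (cyclePairs verts)

open Dicycle public

E : ∀ {r k} → Dicycle r k → List (Vtx r k × Vtx r k)
E C = cyclePairs (verts C)

-- Reachability in G_k − E(C) (same vertex set, arcs of C removed).

data Reach {r k} (C : Dicycle r k) : Vtx r k → Vtx r k → Set where
  here : ∀ {u} → Reach C u u
  step : ∀ {u v x} → Edge u v → ¬ ((u , v) ∈ E C) → Reach C v x → Reach C u x

SameSCC : ∀ {r k} → Dicycle r k → Vtx r k → Vtx r k → Set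
SameSCC C u v = Reach C u v × Reach C v u

StronglyConnectedMinus : ∀ {r k} → Dicycle r k → Set
StronglyConnectedMinus C = ∀ u v → Reach C u v

TwoSCCs : ∀ {r k} → Dicycle r k → Vtx r k → Vtx r k → Set
TwoSCCs C p q = ¬ SameSCC C p q × (∀ v → SameSCC C v p ⊎ SameSCC C v q)

AllExternal : ∀ {r k} → Dicycle r k → Set
AllExternal C = All (λ { (u , v) → Σ (Edge u v) External }) (E C)

AllInternal : ∀ {r k} → Dicycle r k → Set
AllInternal C = All (λ { (u , v) → Σ (Edge u v) Internal }) (E C)

GoodCycle : ∀ {r k} → Vtx r k → Vtx r k → Dicycle r k → Set
GoodCycle p q C = (AllExternal C × TwoSCCs C p q)
                ⊎ (AllInternal C × StronglyConnectedMinus C)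

-- C_1 … C_N partition the arc set of G_k: every arc lies in exactly one E(C_i)
-- (each cycle's pairs are arcs by construction).
Partition : ∀ {r k} (N : ℕ) → (Fin N → Dicycle r k) → Set
Partition {r} {k} N C =
  ∀ (u v : Vtx r k) → Edge u v →
    Σ (Fin N) λ i → ((u , v) ∈ E (C i)) × (∀ j → (u , v) ∈ E (C j) → j ≡ i)

-- G_k has a p,q good decomposition (k ≥ 1; level 0 does not exist).
HasGoodDecomposition : ℕ → ℕ → Set
HasGoodDecomposition r zero    = ⊥
HasGoodDecomposition r (suc n) =
  Σ ℕ λ N → Σ (Fin N → Dicycle r (suc n)) λ C →
    Partition N C × (∀ i → GoodCycle (source n) (sink n) (C i))

module Submission where

-- Every pair (u , v) of vertices of G_k gets a tag naming the cycle of the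
-- decomposition that is to contain the arc u → v.  For G_1 the cycles are
-- the 2-cycles w_i ⇄ w_{i+1}.  For G_{k+2} there are R+1 "top" cycles, each
-- made of arcs of E_{k+2} and of the forward/backward spines (source → sink,
-- sink → source) of one or two copies of G_{k+1}; all remaining arcs lie in
-- copies of G_k two levels down, and are covered by copying the
-- decomposition of G_k into each of them (recursion k ↦ k+2).
--
-- The
-- construction then builds the cycles, shows that they partition the arcs
-- (every arc lies on the cycle of its tag, every cycle arc carries its tag),
-- and verifies the good conditions: removing a 2-cycle or a top cycle leaves
-- a "left" and a "right" strongly connected part separated by an invariant,
-- and removing a doubly copied cycle leaves G_{k+2} strongly connected.

open import Defs
open import Data.Nat using (ℕ; zero; suc; _+_; _*_; _≤_; _<_; z≤n; s≤s)
open import Data.Fin using (Fin; toℕ; fromℕ; inject₁; _≟_) renaming (zero to fzero; suc to fsuc)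
open import Data.Fin.Properties using (toℕ-injective; toℕ-inject₁; toℕ-fromℕ; toℕ<n; 0↔⊥; +↔⊎; *↔×)
import Data.Nat.Properties as ℕP
open import Function using (_↔_; Inverse)
open import Function.Properties.Inverse using (↔-refl; ↔-trans)
open import Data.Sum.Function.Propositional using (_⊎-↔_)
open import Data.Product.Function.NonDependent.Propositional using (_×-↔_)
open import Data.Product using (Σ; _×_; _,_; proj₁; proj₂; uncurry)
open import Data.Sum using (_⊎_; inj₁; inj₂)
open import Data.Empty using (⊥; ⊥-elim)
open import Data.Unit using (⊤; tt)
open import Data.Fin.Relation.Unary.Top using (View; view; ‵fromℕ; ‵inject₁; view-fromℕ; view-inject₁)
open import Data.List.Membership.Propositional.Properties using (∈-map⁺; ∈-map⁻; ∈-++⁺ˡ; ∈-++⁺ʳ)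
import Data.List.Relation.Unary.Unique.Propositional.Properties as UniqueP
import Data.Product as Prod
open import Data.List using (List; []; _∷_; zip; zipWith; _++_; [_]; map)
import Data.List.Properties as ListP
open import Data.List.Membership.Propositional using (_∈_)
open import Data.List.Relation.Unary.Any using (here; there)
open import Data.List.Relation.Unary.All using (All; []; _∷_)
import Data.List.Relation.Unary.All as All
import Data.List.Relation.Unary.All.Properties as AllP
open import Data.List.Relation.Unary.AllPairs using ([]; _∷_)
open import Data.List.Relation.Unary.Unique.Propositional using (Unique)
open import Relation.Binary.Construct.Closure.ReflexiveTransitive
  using (Star; ε; _◅_; _◅◅_; gmap) renaming (map to mapStar)
open import Relation.Nullary using (¬_; yes; no)
open import Relation.Binary.PropositionalEquality hiding ([_])

-- Walks are reflexive–transitive closures 'Star A'.  A walk is recorded by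
-- the list of vertices it visits after its start and by its list of arcs.
module _ {V : Set} {A : V → V → Set} where

  visited : ∀ {x y} → Star A x y → List V
  visited ε                 = []
  visited (_◅_ {j = v} _ p) = v ∷ visited p

  arcsOf : ∀ {x y} → Star A x y → List (V × V)
  arcsOf ε                          = []
  arcsOf (_◅_ {i = u} {j = v} _ p) = (u , v) ∷ arcsOf p

  visited-◅◅ : ∀ {x y z} (p : Star A x y) (q : Star A y z) →
               visited (p ◅◅ q) ≡ visited p ++ visited q
  visited-◅◅ ε       q = refl
  visited-◅◅ (e ◅ p) q = cong (_ ∷_) (visited-◅◅ p q)

  ∈-arcs-◅◅ˡ : ∀ {x y z} (p : Star A x y) (q : Star A y z) {a} →
               a ∈ arcsOf p → a ∈ arcsOf (p ◅◅ q)
  ∈-arcs-◅◅ˡ (e ◅ p) q (here refl) = here refl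
  ∈-arcs-◅◅ˡ (e ◅ p) q (there a∈p) = there (∈-arcs-◅◅ˡ p q a∈p)

  ∈-arcs-◅◅ʳ : ∀ {x y z} (p : Star A x y) (q : Star A y z) {a} →
               a ∈ arcsOf q → a ∈ arcsOf (p ◅◅ q)
  ∈-arcs-◅◅ʳ ε       q a∈q = a∈q
  ∈-arcs-◅◅ʳ (e ◅ p) q a∈q = there (∈-arcs-◅◅ʳ p q a∈q)

  arcsOf-All : ∀ {x y} (p : Star A x y) → All (uncurry A) (arcsOf p)
  arcsOf-All ε       = []
  arcsOf-All (e ◅ p) = e ∷ arcsOf-All p

  closedPairs : ∀ {x y} (p : Star A x y) z →
                zip (x ∷ visited p) (visited p ++ [ z ]) ≡ arcsOf p ++ [ (y , z) ]
  closedPairs ε       z = refl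
  closedPairs (e ◅ p) z = cong (_ ∷_) (closedPairs p z)

  cyclePairs-closed : ∀ {x y} (p : Star A x y) →
                      cyclePairs (x ∷ visited p) ≡ arcsOf p ++ [ (y , x) ]
  cyclePairs-closed {x} p = closedPairs p x

  module _ {_≺_ : V → V → Set} (≺-trans : ∀ {x y z} → x ≺ y → y ≺ z → x ≺ z)
           (≺-irrefl : ∀ {x} → ¬ x ≺ x) (increasing : ∀ {u v} → A u v → u ≺ v) where

    visited-above : ∀ {x y} (p : Star A x y) {z} → z ≺ x → All (z ≺_) (visited p)
    visited-above ε       z≺x = []
    visited-above (e ◅ p) z≺x = let z≺v = ≺-trans z≺x (increasing e) in
                                z≺v ∷ visited-above p z≺v

    monotone-unique : ∀ {x y} (p : Star A x y) → Unique (x ∷ visited p)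
    monotone-unique ε       = [] ∷ []
    monotone-unique (e ◅ p) =
      All.map (λ x≺z x≡z → ≺-irrefl (subst (_ ≺_) (sym x≡z) x≺z))
              (increasing e ∷ visited-above p (increasing e))
      ∷ monotone-unique p

module _ {V W : Set} {A : V → V → Set} {B : W → W → Set}
         (f : V → W) (g : ∀ {u v} → A u v → B (f u) (f v)) where

  mapWalk : ∀ {x y} → Star A x y → Star B (f x) (f y)
  mapWalk = gmap {T = A} {U = B} f g

  visited-mapWalk : ∀ {x y} (p : Star A x y) → visited (mapWalk p) ≡ map f (visited p)
  visited-mapWalk ε       = refl
  visited-mapWalk (e ◅ p) = cong (_ ∷_) (visited-mapWalk p)

  ∈-arcs-mapWalk : ∀ {x y} (p : Star A x y) {u v} →
                (u , v) ∈ arcsOf p → (f u , f v) ∈ arcsOf (mapWalk p)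
  ∈-arcs-mapWalk (e ◅ p) (here refl) = here refl
  ∈-arcs-mapWalk (e ◅ p) (there m)   = there (∈-arcs-mapWalk p m)

cyclePairs-map : ∀ {A B : Set} (f : A → B) (xs : List A) →
                 cyclePairs (map f xs) ≡ map (Prod.map f f) (cyclePairs xs)
cyclePairs-map f []       = refl
cyclePairs-map f (x ∷ xs) = begin
  zip (f x ∷ map f xs) (map f xs ++ [ f x ])
    ≡⟨ cong (zip (f x ∷ map f xs)) (sym (ListP.map-++ f xs [ x ])) ⟩
  zip (map f (x ∷ xs)) (map f (xs ++ [ x ]))
    ≡⟨ ListP.zipWith-map _,_ f f (x ∷ xs) (xs ++ [ x ]) ⟩
  zipWith (λ a b → f a , f b) (x ∷ xs) (xs ++ [ x ])
    ≡⟨ sym (ListP.map-zipWith _,_ (Prod.map f f) (x ∷ xs) (xs ++ [ x ])) ⟩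
  map (Prod.map f f) (cyclePairs (x ∷ xs)) ∎
  where open ≡-Reasoning

module _ {V : Set} {A : V → V → Set} where

  upTo : ∀ {m} (X : Fin (suc m) → V) (a : Fin (suc m)) →
         (∀ i → suc (toℕ i) ≤ toℕ a → A (X (inject₁ i)) (X (fsuc i))) →
         Star A (X fzero) (X a)
  upTo X fzero f = ε
  upTo {suc m} X (fsuc a) f =
    f fzero (s≤s z≤n) ◅ upTo (λ i → X (fsuc i)) a (λ i h → f (fsuc i) (s≤s h))

  upFrom : ∀ {m} (X : Fin (suc m) → V) (a : Fin (suc m)) →
           (∀ i → toℕ a ≤ toℕ i → A (X (inject₁ i)) (X (fsuc i))) →
           Star A (X a) (X (fromℕ m))
  upFrom {zero}  X fzero    f = ε
  upFrom {suc m} X fzero    f =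
    f fzero z≤n ◅ upFrom (λ i → X (fsuc i)) fzero (λ i _ → f (fsuc i) z≤n)
  upFrom {suc m} X (fsuc a) f = upFrom (λ i → X (fsuc i)) a (λ i h → f (fsuc i) (s≤s h))

  downTo : ∀ {m} (X : Fin (suc m) → V) (a : Fin (suc m)) →
           (∀ i → suc (toℕ i) ≤ toℕ a → A (X (fsuc i)) (X (inject₁ i))) →
           Star A (X a) (X fzero)
  downTo X fzero f = ε
  downTo {suc m} X (fsuc a) f =
    downTo (λ i → X (fsuc i)) a (λ i h → f (fsuc i) (s≤s h)) ◅◅ (f fzero (s≤s z≤n) ◅ ε)

  downFrom : ∀ {m} (X : Fin (suc m) → V) (a : Fin (suc m)) →
             (∀ i → toℕ a ≤ toℕ i → A (X (fsuc i)) (X (inject₁ i))) →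
             Star A (X (fromℕ m)) (X a)
  downFrom {m}     X fzero    f = downTo X (fromℕ m) (λ i _ → f i z≤n)
  downFrom {suc m} X (fsuc a) f = downFrom (λ i → X (fsuc i)) a (λ i h → f (fsuc i) (s≤s h))

  ∈-upFrom : ∀ {m} (X : Fin (suc m) → V) a f (i : Fin m) → toℕ a ≤ toℕ i →
             (X (inject₁ i) , X (fsuc i)) ∈ arcsOf (upFrom X a f)
  ∈-upFrom {suc m} X fzero    f fzero    _       = here refl
  ∈-upFrom {suc m} X fzero    f (fsuc i) _       =
    there (∈-upFrom (λ j → X (fsuc j)) fzero _ i z≤n)
  ∈-upFrom {suc m} X (fsuc a) f (fsuc i) (s≤s h) = ∈-upFrom (λ j → X (fsuc j)) a _ i h

  ∈-downTo : ∀ {m} (X : Fin (suc m) → V) a f (i : Fin m) → suc (toℕ i) ≤ toℕ a →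
             (X (fsuc i) , X (inject₁ i)) ∈ arcsOf (downTo X a f)
  ∈-downTo {suc m} X (fsuc a) f fzero    _       =
    ∈-arcs-◅◅ʳ (downTo (λ j → X (fsuc j)) a _) (f fzero (s≤s z≤n) ◅ ε) (here refl)
  ∈-downTo {suc m} X (fsuc a) f (fsuc i) (s≤s h) =
    ∈-arcs-◅◅ˡ (downTo (λ j → X (fsuc j)) a _) (f fzero (s≤s z≤n) ◅ ε)
               (∈-downTo (λ j → X (fsuc j)) a _ i h)

-- Three-way comparison of indices, computed structurally so that the tags
-- below reduce by evaluation.
data Comparison : Set where
  less equal greater : Comparison

compareFin : ∀ {n} → Fin n → Fin n → Comparison
compareFin fzero    fzero    = equal
compareFin fzero    (fsuc _) = less
compareFin (fsuc _) fzero    = greater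
compareFin (fsuc a) (fsuc b) = compareFin a b

compare-refl : ∀ {n} (a : Fin n) → compareFin a a ≡ equal
compare-refl fzero    = refl
compare-refl (fsuc a) = compare-refl a

compare-< : ∀ {n} (i j : Fin n) → toℕ i < toℕ j → compareFin i j ≡ less
compare-< fzero    (fsuc j) _       = refl
compare-< (fsuc i) (fsuc j) (s≤s h) = compare-< i j h

compare-> : ∀ {n} (i j : Fin n) → toℕ j < toℕ i → compareFin i j ≡ greater
compare-> (fsuc i) fzero    _       = refl
compare-> (fsuc i) (fsuc j) (s≤s h) = compare-> i j h

-- The smaller of two indices of Fin (suc (suc n)), as an element of
-- Fin (suc n): the position i of the pair {i, i+1}.
lowerEnd : ∀ {n} → Fin (suc (suc n)) → Fin (suc (suc n)) → Fin (suc n)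
lowerEnd fzero    _        = fzero
lowerEnd (fsuc a) fzero    = fzero
lowerEnd {zero}  (fsuc a) (fsuc b) = fzero
lowerEnd {suc n} (fsuc a) (fsuc b) = fsuc (lowerEnd a b)

lowerEnd-up : ∀ {n} (i : Fin (suc n)) → lowerEnd (inject₁ i) (fsuc i) ≡ i
lowerEnd-up fzero            = refl
lowerEnd-up {suc n} (fsuc i) = cong fsuc (lowerEnd-up i)

lowerEnd-down : ∀ {n} (i : Fin (suc n)) → lowerEnd (fsuc i) (inject₁ i) ≡ i
lowerEnd-down {zero}  fzero    = refl
lowerEnd-down {suc n} fzero    = refl
lowerEnd-down {suc n} (fsuc i) = cong fsuc (lowerEnd-down i)

inject₁<suc : ∀ {n} (i : Fin n) → toℕ (inject₁ i) < toℕ (fsuc i)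
inject₁<suc i = s≤s (ℕP.≤-reflexive (toℕ-inject₁ i))

inject₁≢suc : ∀ {n} (i : Fin n) → inject₁ i ≢ fsuc i
inject₁≢suc i eq = ℕP.<-irrefl (cong toℕ eq) (inject₁<suc i)

consecutive : ∀ {n} (i j : Fin (suc n)) → suc (toℕ i) ≡ toℕ j →
              Σ (Fin n) λ b → i ≡ inject₁ b × j ≡ fsuc b
consecutive i (fsuc b) h =
  b , toℕ-injective (trans (ℕP.suc-injective h) (sym (toℕ-inject₁ b))) , refl

lastIndex : ∀ {n} (i : Fin (suc n)) → suc (toℕ i) ≡ suc n → i ≡ fromℕ n
lastIndex {n} i h = toℕ-injective (trans (ℕP.suc-injective h) (sym (toℕ-fromℕ n)))

partitionByTags : ∀ {r k N} {Tag : Set} (enum : Fin N ↔ Tag)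
                  (cycle : Tag → Dicycle r k) (tag : Vtx r k → Vtx r k → Tag) →
                  (∀ {u v} → Edge u v → (u , v) ∈ E (cycle (tag u v))) →
                  (∀ τ {u v} → (u , v) ∈ E (cycle τ) → tag u v ≡ τ) →
                  Partition N (λ i → cycle (Inverse.to enum i))
partitionByTags enum cycle tag onOwnCycle tagged u v e =
  from (tag u v) ,
  subst (λ τ → (u , v) ∈ E (cycle τ)) (sym (strictlyInverseˡ (tag u v))) (onOwnCycle e) ,
  λ j uv∈j → trans (sym (strictlyInverseʳ j)) (cong from (sym (tagged (to j) uv∈j)))
  where open Inverse enum

Avoiding : ∀ {r k} → Dicycle r k → Vtx r k → Vtx r k → Set
Avoiding C u v = Edge u v × ¬ ((u , v) ∈ E C)

walk⇒reach : ∀ {r k} {C : Dicycle r k} {x y} → Star (Avoiding C) x y → Reach C x y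
walk⇒reach ε             = here
walk⇒reach ((e , n) ◅ p) = step e n (walk⇒reach p)

reach⇒walk : ∀ {r k} {C : Dicycle r k} {x y} → Reach C x y → Star (Avoiding C) x y
reach⇒walk here         = ε
reach⇒walk (step e n p) = (e , n) ◅ reach⇒walk p

module _ {r k : ℕ} where

  cp-injective : ∀ {a : Fin r} {x y : Vtx r (suc k)} → cp a x ≡ cp a y → x ≡ y
  cp-injective refl = refl

  cp-index : ∀ {a b : Fin r} {x y : Vtx r (suc k)} → cp a x ≡ cp b y → a ≡ b
  cp-index refl = refl

  unique-in-copy : ∀ (a : Fin r) {xs : List (Vtx r (suc k))} → Unique xs → Unique (map (cp a) xs)
  unique-in-copy a = UniqueP.map⁺ cp-injective

  unique-two-copies : ∀ {a b : Fin r} → a ≢ b → {xs ys : List (Vtx r (suc k))} →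
                      Unique xs → Unique ys → Unique (map (cp a) xs ++ map (cp b) ys)
  unique-two-copies {a} {b} a≢b {xs} {ys} xs! ys! =
    UniqueP.++⁺ (unique-in-copy a xs!) (unique-in-copy b ys!) disjoint
    where
    disjoint : ∀ {z} → ¬ (z ∈ map (cp a) xs × z ∈ map (cp b) ys)
    disjoint (m₁ , m₂) with ∈-map⁻ (cp a) m₁ | ∈-map⁻ (cp b) m₂
    ... | _ , _ , refl | _ , _ , eq = a≢b (cp-index eq)

  terminal-outside-copy : ∀ {z : Vtx r (suc (suc k))} → (∀ {a x} → z ≢ cp a x) →
                          ∀ (a : Fin r) xs → All (z ≢_) (map (cp a) xs)
  terminal-outside-copy z∉ a []       = []
  terminal-outside-copy z∉ a (x ∷ xs) = z∉ ∷ terminal-outside-copy z∉ a xs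

  liftCycle : Fin r → Dicycle r (suc k) → Dicycle r (suc (suc k))
  liftCycle a C = record
    { verts    = map (cp a) (verts C)
    ; nonempty = map-nonempty (verts C) (nonempty C)
    ; distinct = unique-in-copy a (distinct C)
    ; arcs     = subst (All (uncurry Edge)) (sym (cyclePairs-map (cp a) (verts C)))
                       (AllP.map⁺ (All.map (lift a) (arcs C)))
    }
    where
    map-nonempty : ∀ xs → xs ≢ [] → map (cp a) xs ≢ []
    map-nonempty []      xs≢[] _ = xs≢[] refl
    map-nonempty (_ ∷ _) _     ()

  E-liftCycle : ∀ a (C : Dicycle r (suc k)) → E (liftCycle a C) ≡ map (Prod.map (cp a) (cp a)) (E C)
  E-liftCycle a C = cyclePairs-map (cp a) (verts C)

  ∈-liftCycle⁺ : ∀ a (C : Dicycle r (suc k)) {x y} → (x , y) ∈ E C → (cp a x , cp a y) ∈ E (liftCycle a C)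
  ∈-liftCycle⁺ a C m = subst (_ ∈_) (sym (E-liftCycle a C)) (∈-map⁺ (Prod.map (cp a) (cp a)) m)

  ∈-liftCycle⁻ : ∀ a (C : Dicycle r (suc k)) {u v} → (u , v) ∈ E (liftCycle a C) →
                 Σ (Vtx r (suc k) × Vtx r (suc k)) λ (x , y) → (x , y) ∈ E C × u ≡ cp a x × v ≡ cp a y
  ∈-liftCycle⁻ a C m with ∈-map⁻ (Prod.map (cp a) (cp a)) (subst (_ ∈_) (E-liftCycle a C) m)
  ... | xy , xy∈C , refl = xy , xy∈C , refl , refl

record ClosedWalk {r k : ℕ} (A : Vtx r k → Vtx r k → Set) : Set where
  field
    start end : Vtx r k
    walk      : Star A start end
    closing   : A end start
    distinct  : Unique (start ∷ visited walk)

module _ {r k : ℕ} {A : Vtx r k → Vtx r k → Set} (arc : ∀ {u v} → A u v → Edge u v) where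
  open ClosedWalk

  closedWalkArcs : (W : ClosedWalk A) → All (uncurry A) (cyclePairs (start W ∷ visited (walk W)))
  closedWalkArcs W = subst (All (uncurry A)) (sym (cyclePairs-closed (walk W)))
                           (AllP.++⁺ (arcsOf-All (walk W)) (closing W ∷ []))

  toDicycle : ClosedWalk A → Dicycle r k
  toDicycle W = record
    { verts    = start W ∷ visited (walk W)
    ; nonempty = λ ()
    ; distinct = distinct W
    ; arcs     = All.map arc (closedWalkArcs W)
    }

  ∈-walk : ∀ (W : ClosedWalk A) {a} → a ∈ arcsOf (walk W) → a ∈ E (toDicycle W)
  ∈-walk W m = subst (_ ∈_) (sym (cyclePairs-closed (walk W))) (∈-++⁺ˡ m)

  ∈-closing : ∀ (W : ClosedWalk A) → (end W , start W) ∈ E (toDicycle W)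
  ∈-closing W = subst (_ ∈_) (sym (cyclePairs-closed (walk W)))
                      (∈-++⁺ʳ (arcsOf (walk W)) (here refl))

-- The construction for r = suc r' copies, numbered 0 … R−1 (copy a is the
-- paper's G^{(a+1)}); u_a, v_a are the source and sink of copy a.
module Construction (r' : ℕ) where

  R : ℕ
  R = suc r'

  V : ℕ → Set
  V = Vtx R

  -- Names of the cycles of the decomposition of G_k: for G_1 the 2-cycle
  -- w_i ⇄ w_{i+1}; for G_{k+2} either one of the R+1 "top" cycles, or a cycle
  -- of G_k carried into copy b of copy a.
  Tag : ℕ → Set
  Tag zero          = ⊥
  Tag (suc zero)    = Fin (suc R)
  Tag (suc (suc k)) = Fin (suc R) ⊎ (Fin R × Fin R × Tag k)

  -- How a pair of vertices of G_{k+1} looks from inside G_{k+2}: an arc of the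
  -- forward spine source → sink, of the backward spine sink → source, or an
  -- arc inside copy b carrying a tag of G_k.
  data Kind (k : ℕ) : Set where
    forward backward : Kind k
    inside           : Fin R → Tag k → Kind k

  kindTag : ∀ {k} → Fin R → Kind k → Tag (suc (suc k))
  kindTag a forward      = inj₁ (inject₁ a)
  kindTag a backward     = inj₁ (fsuc a)
  kindTag a (inside b τ) = inj₂ (a , b , τ)

  -- The tag of a pair (u , v) names the cycle containing the arc u → v.
  mutual
    tag : ∀ {k} → V k → V k → Tag k
    tag (w a)    (w b)    = lowerEnd a b
    tag src      _        = inj₁ fzero
    tag snk      _        = inj₁ (fromℕ R)
    tag (cp a x) src      = inj₁ fzero
    tag (cp a x) snk      = inj₁ (fromℕ R)
    tag (cp a x) (cp b y) = tagAcross (compareFin a b) a b x y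

    tagAcross : ∀ {k} → Comparison → Fin R → Fin R → V (suc k) → V (suc k) → Tag (suc (suc k))
    tagAcross less    a b x y = inj₁ (fsuc a)
    tagAcross equal   a b x y = kindTag a (kind x y)
    tagAcross greater a b x y = inj₁ (fsuc b)

    kind : ∀ {k} → V (suc k) → V (suc k) → Kind k
    kind (w a)    (w b)    = kindOnPath (compareFin a b)
    kind src      _        = forward
    kind snk      _        = backward
    kind (cp a x) src      = backward
    kind (cp a x) snk      = forward
    kind (cp a x) (cp b y) = kindAcross (compareFin a b) a (tag x y)

    kindOnPath : ∀ {k} → Comparison → Kind k
    kindOnPath less    = forward
    kindOnPath equal   = backward
    kindOnPath greater = backward

    kindAcross : ∀ {k} → Comparison → Fin R → Tag k → Kind k
    kindAcross less    a τ = forward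
    kindAcross equal   a τ = inside a τ
    kindAcross greater a τ = backward

  tag-lift : ∀ {k} a (x y : V (suc k)) → tag (cp a x) (cp a y) ≡ kindTag a (kind x y)
  tag-lift a x y rewrite compare-refl a = refl

  kind-lift : ∀ {k} a (x y : V (suc k)) → kind (cp a x) (cp a y) ≡ inside a (tag x y)
  kind-lift a x y rewrite compare-refl a = refl

  tag-ascending : ∀ {k} (i j : Fin R) (x y : V (suc k)) → toℕ i < toℕ j →
                  tag (cp i x) (cp j y) ≡ inj₁ (fsuc i)
  tag-ascending i j x y i<j rewrite compare-< i j i<j = refl

  tag-descending : ∀ {k} (i j : Fin R) (x y : V (suc k)) → toℕ i < toℕ j →
                   tag (cp j x) (cp i y) ≡ inj₁ (fsuc i)
  tag-descending i j x y i<j rewrite compare-> j i i<j = refl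

  kind-ascending : ∀ {k} (i j : Fin R) (x y : V (suc k)) → toℕ i < toℕ j →
                   kind (cp i x) (cp j y) ≡ forward
  kind-ascending i j x y i<j rewrite compare-< i j i<j = refl

  kind-descending : ∀ {k} (i j : Fin R) (x y : V (suc k)) → toℕ i < toℕ j →
                    kind (cp j x) (cp i y) ≡ backward
  kind-descending i j x y i<j rewrite compare-> j i i<j = refl

  kind-fwd : (i : Fin (suc R)) → kind (w (inject₁ i)) (w (fsuc i)) ≡ forward {0}
  kind-fwd i rewrite compare-< (inject₁ i) (fsuc i) (inject₁<suc i) = refl

  kind-bwd : (i : Fin (suc R)) → kind (w (fsuc i)) (w (inject₁ i)) ≡ backward {0}
  kind-bwd i rewrite compare-> (fsuc i) (inject₁ i) (inject₁<suc i) = refl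

  entry exit : ∀ k → Fin R → V (suc (suc k))
  entry k a = cp a (source k)
  exit  k a = cp a (sink k)

  arc-pu : ∀ k → Edge src (entry k fzero)
  arc-pu k = p→u fzero refl

  arc-uu : ∀ k (i : Fin r') → Edge (entry k (inject₁ i)) (entry k (fsuc i))
  arc-uu k i = u→u (inject₁ i) (fsuc i) (cong suc (toℕ-inject₁ i))

  arc-uq : ∀ k → Edge (entry k (fromℕ r')) snk
  arc-uq k = u→q (fromℕ r') (cong suc (toℕ-fromℕ r'))

  arc-qv : ∀ k → Edge snk (exit k (fromℕ r'))
  arc-qv k = q→v (fromℕ r') (cong suc (toℕ-fromℕ r'))

  arc-vv : ∀ k (i : Fin r') → Edge (exit k (fsuc i)) (exit k (inject₁ i))
  arc-vv k i = v→v (inject₁ i) (fsuc i) (cong suc (toℕ-inject₁ i))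

  arc-vp : ∀ k → Edge (exit k fzero) src
  arc-vp k = v→p fzero refl

  TopArc : ∀ k → Kind k → V (suc k) → V (suc k) → Set
  TopArc k κ x y = Σ (Edge x y) Top × kind x y ≡ κ

  fwdArc : (i : Fin (suc R)) → TopArc 0 forward (w (inject₁ i)) (w (fsuc i))
  fwdArc i = (fwd i , tt) , kind-fwd i

  bwdArc : (i : Fin (suc R)) → TopArc 0 backward (w (fsuc i)) (w (inject₁ i))
  bwdArc i = (bwd i , tt) , kind-bwd i

  entryArc : ∀ k (i : Fin r') → TopArc (suc k) forward (entry k (inject₁ i)) (entry k (fsuc i))
  entryArc k i = (arc-uu k i , tt) , kind-ascending (inject₁ i) (fsuc i) (source k) (source k) (inject₁<suc i)

  exitArc : ∀ k (i : Fin r') → TopArc (suc k) backward (exit k (fsuc i)) (exit k (inject₁ i))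
  exitArc k i = (arc-vv k i , tt) , kind-descending (inject₁ i) (fsuc i) (sink k) (sink k) (inject₁<suc i)

  pathForward : Star (TopArc 0 forward) (w fzero) (w (fromℕ (suc R)))
  pathForward = upFrom w fzero (λ i _ → fwdArc i)

  pathBackward : Star (TopArc 0 backward) (w (fromℕ (suc R))) (w fzero)
  pathBackward = downTo w (fromℕ (suc R)) (λ i _ → bwdArc i)

  entryChain : ∀ k → Star (TopArc (suc k) forward) (entry k fzero) (entry k (fromℕ r'))
  entryChain k = upFrom (entry k) fzero (λ i _ → entryArc k i)

  exitChain : ∀ k → Star (TopArc (suc k) backward) (exit k (fromℕ r')) (exit k fzero)
  exitChain k = downTo (exit k) (fromℕ r') (λ i _ → exitArc k i)

  forwardSpine : ∀ k → Star (TopArc k forward) (source k) (sink k)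
  forwardSpine zero    = pathForward
  forwardSpine (suc k) = ((arc-pu k , tt) , refl) ◅ (entryChain k ◅◅ (((arc-uq k , tt) , refl) ◅ ε))

  backwardSpine : ∀ k → Star (TopArc k backward) (sink k) (source k)
  backwardSpine zero    = pathBackward
  backwardSpine (suc k) = ((arc-qv k , tt) , refl) ◅ (exitChain k ◅◅ (((arc-vp k , tt) , refl) ◅ ε))

  onSpine : ∀ {k} {x y : V (suc k)} (e : Edge x y) → Top e →
            (kind x y ≡ forward × (x , y) ∈ arcsOf (forwardSpine k))
            ⊎ (kind x y ≡ backward × (x , y) ∈ arcsOf (backwardSpine k))
  onSpine (fwd i) _ = inj₁ (kind-fwd i , ∈-upFrom w fzero (λ i _ → fwdArc i) i z≤n)
  onSpine (bwd i) _ =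
    inj₂ (kind-bwd i , ∈-downTo w (fromℕ (suc R)) (λ i _ → bwdArc i) i
                         (subst (suc (toℕ i) ≤_) (sym (toℕ-fromℕ (suc R))) (toℕ<n i)))
  onSpine (p→u fzero _) _ = inj₁ (refl , here refl)
  onSpine {suc k} (u→u i j h) _ with consecutive i j h
  ... | b , refl , refl =
    inj₁ (kind-ascending (inject₁ b) (fsuc b) (source k) (source k) (inject₁<suc b) ,
          there (∈-arcs-◅◅ˡ (entryChain k) _ (∈-upFrom (entry k) fzero (λ i _ → entryArc k i) b z≤n)))
  onSpine {suc k} (u→q i h) _ with lastIndex i h
  ... | refl = inj₁ (refl , there (∈-arcs-◅◅ʳ (entryChain k) _ (here refl)))
  onSpine {suc k} (q→v i h) _ with lastIndex i h
  ... | refl = inj₂ (refl , here refl)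
  onSpine {suc k} (v→v i j h) _ with consecutive i j h
  ... | b , refl , refl =
    inj₂ (kind-descending (inject₁ b) (fsuc b) (sink k) (sink k) (inject₁<suc b) ,
          there (∈-arcs-◅◅ˡ (exitChain k) _
                  (∈-downTo (exit k) (fromℕ r') (λ i _ → exitArc k i) b
                     (subst (suc (toℕ b) ≤_) (sym (toℕ-fromℕ r')) (toℕ<n b)))))
  onSpine {suc k} (v→p fzero _) _ = inj₂ (refl , there (∈-arcs-◅◅ʳ (exitChain k) _ (here refl)))

  -- Position of a vertex along the spines: forward arcs increase it,
  -- backward arcs decrease it.
  rank : ∀ {k} → V k → ℕ
  rank (w a)    = toℕ a
  rank src      = 0
  rank snk      = suc R
  rank (cp a _) = suc (toℕ a)

  top-arc-direction : ∀ {k} {x y : V (suc k)} (e : Edge x y) → Top e →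
                      (kind x y ≡ forward × rank x < rank y) ⊎ (kind x y ≡ backward × rank y < rank x)
  top-arc-direction (fwd i)     _ = inj₁ (kind-fwd i , inject₁<suc i)
  top-arc-direction (bwd i)     _ = inj₂ (kind-bwd i , inject₁<suc i)
  top-arc-direction (p→u i h)   _ = inj₁ (refl , s≤s z≤n)
  top-arc-direction {suc k} (u→u i j h) _ =
    inj₁ (kind-ascending i j (source k) (source k) (ℕP.≤-reflexive h) , s≤s (ℕP.≤-reflexive h))
  top-arc-direction (u→q i h)   _ = inj₁ (refl , s≤s (toℕ<n i))
  top-arc-direction (q→v i h)   _ = inj₂ (refl , s≤s (toℕ<n i))
  top-arc-direction {suc k} (v→v i j h) _ =
    inj₂ (kind-descending i j (sink k) (sink k) (ℕP.≤-reflexive h) , s≤s (ℕP.≤-reflexive h))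
  top-arc-direction (v→p i h)   _ = inj₂ (refl , s≤s z≤n)

  forward≢backward : ∀ {k} → forward {k} ≢ backward
  forward≢backward ()

  forwardSpine-distinct : ∀ k → Unique (source k ∷ visited (forwardSpine k))
  forwardSpine-distinct k = monotone-unique ℕP.<-trans (ℕP.<-irrefl refl) increasing (forwardSpine k)
    where
    increasing : ∀ {x y} → TopArc k forward x y → rank x < rank y
    increasing ((e , top) , κ) with top-arc-direction e top
    ... | inj₁ (_ , lt) = lt
    ... | inj₂ (κ′ , _) = ⊥-elim (forward≢backward (trans (sym κ) κ′))

  backwardSpine-distinct : ∀ k → Unique (sink k ∷ visited (backwardSpine k))
  backwardSpine-distinct k =
    monotone-unique {_≺_ = λ x y → rank y < rank x} (λ p q → ℕP.<-trans q p) (ℕP.<-irrefl refl)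
                    decreasing (backwardSpine k)
    where
    decreasing : ∀ {x y} → TopArc k backward x y → rank y < rank x
    decreasing ((e , top) , κ) with top-arc-direction e top
    ... | inj₁ (κ′ , _) = ⊥-elim (forward≢backward (trans (sym κ′) κ))
    ... | inj₂ (_ , lt) = lt

  TaggedArc : ∀ k → Tag k → V k → V k → Set
  TaggedArc k τ u v = Σ (Edge u v) External × tag u v ≡ τ

  TaggedCycle : ∀ k → Tag k → Set
  TaggedCycle k τ = ClosedWalk (TaggedArc k τ)

  taggedDicycle : ∀ {k τ} → TaggedCycle k τ → Dicycle R k
  taggedDicycle = toDicycle (λ a → proj₁ (proj₁ a))

  liftSpineArc : ∀ {k κ} a {x y : V (suc k)} → TopArc k κ x y →
                 TaggedArc (suc (suc k)) (kindTag a κ) (cp a x) (cp a y)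
  liftSpineArc a {x} {y} ((e , top) , κ) = (lift a e , top) , trans (tag-lift a x y) (cong (kindTag a) κ)

  liftSpine : ∀ {k κ} a {x y : V (suc k)} → Star (TopArc k κ) x y →
              Star (TaggedArc (suc (suc k)) (kindTag a κ)) (cp a x) (cp a y)
  liftSpine a = mapWalk (cp a) (liftSpineArc a)

  visited-liftSpine : ∀ {k κ} a {x y : V (suc k)} (p : Star (TopArc k κ) x y) →
                      visited (liftSpine a p) ≡ map (cp a) (visited p)
  visited-liftSpine a = visited-mapWalk (cp a) (liftSpineArc a)

  w-injective : ∀ {a b : Fin (suc (suc R))} → w a ≡ w b → a ≡ b
  w-injective refl = refl

  twoCycle : (i : Fin (suc R)) → TaggedCycle 1 i
  twoCycle i = record
    { start    = w (inject₁ i)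
    ; end      = w (fsuc i)
    ; walk     = ((fwd i , tt) , lowerEnd-up i) ◅ ε
    ; closing  = (bwd i , tt) , lowerEnd-down i
    ; distinct = ((λ eq → inject₁≢suc i (w-injective eq)) ∷ []) ∷ [] ∷ []
    }

  firstCycle : ∀ k → TaggedCycle (suc (suc k)) (inj₁ fzero)
  firstCycle k = record
    { start    = src
    ; end      = exit k fzero
    ; walk     = ((arc-pu k , tt) , refl) ◅ liftSpine fzero (forwardSpine k)
    ; closing  = (arc-vp k , tt) , refl
    ; distinct = subst (λ vs → Unique (src ∷ entry k fzero ∷ vs)) (sym (visited-liftSpine fzero (forwardSpine k)))
                   (terminal-outside-copy (λ ()) fzero (source k ∷ visited (forwardSpine k))
                    ∷ unique-in-copy fzero (forwardSpine-distinct k))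
    }

  lastCycle : ∀ k → TaggedCycle (suc (suc k)) (inj₁ (fromℕ R))
  lastCycle k = record
    { start    = snk
    ; end      = entry k (fromℕ r')
    ; walk     = ((arc-qv k , tt) , refl) ◅ liftSpine (fromℕ r') (backwardSpine k)
    ; closing  = (arc-uq k , tt) , refl
    ; distinct = subst (λ vs → Unique (snk ∷ exit k (fromℕ r') ∷ vs))
                   (sym (visited-liftSpine (fromℕ r') (backwardSpine k)))
                   (terminal-outside-copy (λ ()) (fromℕ r') (sink k ∷ visited (backwardSpine k))
                    ∷ unique-in-copy (fromℕ r') (backwardSpine-distinct k))
    }

  middleCycle : ∀ k (b : Fin r') → TaggedCycle (suc (suc k)) (inj₁ (fsuc (inject₁ b)))
  middleCycle k b = record
    { start    = entry k (fsuc b)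
    ; end      = entry k (inject₁ b)
    ; walk     = route
    ; closing  = (arc-uu k b , tt) ,
                 tag-ascending (inject₁ b) (fsuc b) (source k) (source k) (inject₁<suc b)
    ; distinct = subst Unique (sym vertices)
                   (unique-two-copies (λ eq → inject₁≢suc b (sym eq))
                      (forwardSpine-distinct k) (backwardSpine-distinct k))
    }
    where
    arc-across : TaggedArc (suc (suc k)) (inj₁ (fsuc (inject₁ b))) (exit k (fsuc b)) (exit k (inject₁ b))
    arc-across = (arc-vv k b , tt) ,
                 tag-descending (inject₁ b) (fsuc b) (sink k) (sink k) (inject₁<suc b)

    route : Star (TaggedArc (suc (suc k)) (inj₁ (fsuc (inject₁ b)))) (entry k (fsuc b)) (entry k (inject₁ b))
    route = liftSpine (fsuc b) (forwardSpine k) ◅◅ (arc-across ◅ liftSpine (inject₁ b) (backwardSpine k))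

    vertices : entry k (fsuc b) ∷ visited route
             ≡ map (cp (fsuc b)) (source k ∷ visited (forwardSpine k))
               ++ map (cp (inject₁ b)) (sink k ∷ visited (backwardSpine k))
    vertices = cong (entry k (fsuc b) ∷_)
      (trans (visited-◅◅ (liftSpine (fsuc b) (forwardSpine k)) (arc-across ◅ liftSpine (inject₁ b) (backwardSpine k)))
             (cong₂ (λ xs ys → xs ++ exit k (inject₁ b) ∷ ys)
                    (visited-liftSpine (fsuc b) (forwardSpine k))
                    (visited-liftSpine (inject₁ b) (backwardSpine k))))

  laterCycle : ∀ k {a : Fin R} → View a → TaggedCycle (suc (suc k)) (inj₁ (fsuc a))
  laterCycle k ‵fromℕ       = lastCycle k
  laterCycle k (‵inject₁ b) = middleCycle k b

  topCycle : ∀ k (t : Fin (suc R)) → TaggedCycle (suc (suc k)) (inj₁ t)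
  topCycle k fzero    = firstCycle k
  topCycle k (fsuc a) = laterCycle k (view a)

  topCycle-last : ∀ k → topCycle k (fromℕ R) ≡ lastCycle k
  topCycle-last k = cong (laterCycle k) (view-fromℕ r')

  topCycle-middle : ∀ k b → topCycle k (fsuc (inject₁ b)) ≡ middleCycle k b
  topCycle-middle k b = cong (laterCycle k) (view-inject₁ b)

  cycle : ∀ {k} → Tag k → Dicycle R k
  cycle {suc zero}          i                    = taggedDicycle (twoCycle i)
  cycle {suc (suc k)}       (inj₁ t)             = taggedDicycle (topCycle k t)
  cycle {suc (suc (suc k))} (inj₂ (a , b , τ))   = liftCycle a (liftCycle b (cycle τ))

  taggedCycle-arcs : ∀ {k τ} (W : TaggedCycle k τ) → All (uncurry (TaggedArc k τ)) (E (taggedDicycle W))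
  taggedCycle-arcs = closedWalkArcs (λ a → proj₁ (proj₁ a))

  ∈-taggedWalk : ∀ {k τ} (W : TaggedCycle k τ) {a} → a ∈ arcsOf (ClosedWalk.walk W) → a ∈ E (taggedDicycle W)
  ∈-taggedWalk = ∈-walk (λ a → proj₁ (proj₁ a))

  ∈-taggedClosing : ∀ {k τ} (W : TaggedCycle k τ) →
                    (ClosedWalk.end W , ClosedWalk.start W) ∈ E (taggedDicycle W)
  ∈-taggedClosing = ∈-closing (λ a → proj₁ (proj₁ a))

  tagged : ∀ {k} (τ : Tag k) {u v} → (u , v) ∈ E (cycle τ) → tag u v ≡ τ
  tagged {suc zero}    i        m = proj₂ (All.lookup (taggedCycle-arcs (twoCycle i)) m)
  tagged {suc (suc k)} (inj₁ t) m = proj₂ (All.lookup (taggedCycle-arcs (topCycle k t)) m)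
  tagged {suc (suc (suc k))} (inj₂ (a , b , τ)) m with ∈-liftCycle⁻ a (liftCycle b (cycle τ)) m
  ... | _ , m′ , refl , refl with ∈-liftCycle⁻ b (cycle τ) m′
  ... | (x , y) , m″ , refl , refl =
    trans (tag-lift a (cp b x) (cp b y))
          (cong (kindTag a) (trans (kind-lift b x y) (cong (inside b) (tagged τ m″))))

  forwardSpine-onTop : ∀ k a {x y} → (x , y) ∈ arcsOf (forwardSpine k) →
                       (cp a x , cp a y) ∈ E (cycle {suc (suc k)} (inj₁ (inject₁ a)))
  forwardSpine-onTop k fzero    m =
    ∈-taggedWalk (firstCycle k) (there (∈-arcs-mapWalk (cp fzero) (liftSpineArc fzero) (forwardSpine k) m))
  forwardSpine-onTop k (fsuc c) {x} {y} m =
    subst (λ W → (cp (fsuc c) x , cp (fsuc c) y) ∈ E (taggedDicycle W)) (sym (topCycle-middle k c))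
      (∈-taggedWalk (middleCycle k c)
        (∈-arcs-◅◅ˡ (liftSpine (fsuc c) (forwardSpine k)) _
          (∈-arcs-mapWalk (cp (fsuc c)) (liftSpineArc (fsuc c)) (forwardSpine k) m)))

  backwardSpine-onTop : ∀ k a {x y} → (x , y) ∈ arcsOf (backwardSpine k) →
                        (cp a x , cp a y) ∈ E (cycle {suc (suc k)} (inj₁ (fsuc a)))
  backwardSpine-onTop k a m with view a
  ... | ‵fromℕ =
    ∈-taggedWalk (lastCycle k)
      (there (∈-arcs-mapWalk (cp (fromℕ r')) (liftSpineArc (fromℕ r')) (backwardSpine k) m))
  ... | ‵inject₁ b =
    ∈-taggedWalk (middleCycle k b)
      (∈-arcs-◅◅ʳ (liftSpine (fsuc b) (forwardSpine k)) _
        (there (∈-arcs-mapWalk (cp (inject₁ b)) (liftSpineArc (inject₁ b)) (backwardSpine k) m)))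

  onTopCycle : ∀ k {t} {W : TaggedCycle (suc (suc k)) (inj₁ t)} {a} →
               W ≡ topCycle k t → a ∈ E (taggedDicycle W) → a ∈ E (cycle {suc (suc k)} (inj₁ t))
  onTopCycle k refl m = m

  onSpine-lift : ∀ {k} a {x y : V (suc k)} (e : Edge x y) → Top e →
                 (cp a x , cp a y) ∈ E (cycle {suc (suc k)} (kindTag a (kind x y)))
  onSpine-lift {k} a e top with onSpine e top
  ... | inj₁ (κ , m) rewrite κ = forwardSpine-onTop k a m
  ... | inj₂ (κ , m) rewrite κ = backwardSpine-onTop k a m

  mutual
    onOwnCycle : ∀ {k} {u v : V k} → Edge u v → (u , v) ∈ E (cycle (tag u v))
    onOwnCycle (fwd i) rewrite lowerEnd-up i   = ∈-taggedWalk (twoCycle i) (here refl)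
    onOwnCycle (bwd i) rewrite lowerEnd-down i = ∈-taggedClosing (twoCycle i)
    onOwnCycle {suc (suc k)} (p→u fzero _) = ∈-taggedWalk (firstCycle k) (here refl)
    onOwnCycle {suc (suc k)} (v→p fzero _) = ∈-taggedClosing (firstCycle k)
    onOwnCycle {suc (suc k)} (u→q i h) with lastIndex i h
    ... | refl = onTopCycle k (sym (topCycle-last k)) (∈-taggedClosing (lastCycle k))
    onOwnCycle {suc (suc k)} (q→v i h) with lastIndex i h
    ... | refl = onTopCycle k (sym (topCycle-last k)) (∈-taggedWalk (lastCycle k) (here refl))
    onOwnCycle {suc (suc k)} (u→u i j h) with consecutive i j h
    ... | b , refl , refl
      rewrite tag-ascending (inject₁ b) (fsuc b) (source k) (source k) (inject₁<suc b) =
      onTopCycle k (sym (topCycle-middle k b)) (∈-taggedClosing (middleCycle k b))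
    onOwnCycle {suc (suc k)} (v→v i j h) with consecutive i j h
    ... | b , refl , refl
      rewrite tag-descending (inject₁ b) (fsuc b) (sink k) (sink k) (inject₁<suc b) =
      onTopCycle k (sym (topCycle-middle k b))
        (∈-taggedWalk (middleCycle k b) (∈-arcs-◅◅ʳ (liftSpine (fsuc b) (forwardSpine k)) _ (here refl)))
    onOwnCycle (lift a {x} {y} e) rewrite tag-lift a x y = onOwnCycle-lift a e

    onOwnCycle-lift : ∀ {k} a {x y : V (suc k)} (e : Edge x y) →
                      (cp a x , cp a y) ∈ E (cycle {suc (suc k)} (kindTag a (kind x y)))
    onOwnCycle-lift a (lift b {x} {y} e) rewrite kind-lift b x y =
      ∈-liftCycle⁺ a (liftCycle b (cycle (tag x y))) (∈-liftCycle⁺ b (cycle (tag x y)) (onOwnCycle e))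
    onOwnCycle-lift a e@(fwd _)     = onSpine-lift a e tt
    onOwnCycle-lift a e@(bwd _)     = onSpine-lift a e tt
    onOwnCycle-lift a e@(p→u _ _)   = onSpine-lift a e tt
    onOwnCycle-lift a e@(u→u _ _ _) = onSpine-lift a e tt
    onOwnCycle-lift a e@(u→q _ _)   = onSpine-lift a e tt
    onOwnCycle-lift a e@(q→v _ _)   = onSpine-lift a e tt
    onOwnCycle-lift a e@(v→v _ _ _) = onSpine-lift a e tt
    onOwnCycle-lift a e@(v→p _ _)   = onSpine-lift a e tt

  tagCount : ℕ → ℕ
  tagCount zero          = 0
  tagCount (suc zero)    = suc R
  tagCount (suc (suc k)) = suc R + R * (R * tagCount k)

  enumerateTags : ∀ k → Fin (tagCount k) ↔ Tag k
  enumerateTags zero          = 0↔⊥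
  enumerateTags (suc zero)    = ↔-refl
  enumerateTags (suc (suc k)) =
    ↔-trans +↔⊎ (↔-refl ⊎-↔ ↔-trans *↔× (↔-refl ×-↔ ↔-trans *↔× (↔-refl ×-↔ enumerateTags k)))

  decomposition : ∀ k → Fin (tagCount k) → Dicycle R k
  decomposition k i = cycle (Inverse.to (enumerateTags k) i)

  decomposition-partition : ∀ k → Partition (tagCount k) (decomposition k)
  decomposition-partition k = partitionByTags (enumerateTags k) cycle tag onOwnCycle tagged

  NotOfKind : ∀ k → Kind k → V (suc k) → V (suc k) → Set
  NotOfKind k κ x y = Edge x y × kind x y ≢ κ

  forward⇒notBackward : ∀ {k x y} → TopArc k forward x y → NotOfKind k backward x y
  forward⇒notBackward ((e , _) , κ) = e , λ κ′ → forward≢backward (trans (sym κ) κ′)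

  backward⇒notForward : ∀ {k x y} → TopArc k backward x y → NotOfKind k forward x y
  backward⇒notForward ((e , _) , κ) = e , λ κ′ → forward≢backward (trans (sym κ′) κ)

  liftWalk : ∀ {k} {κ : Kind (suc k)} → (∀ {b τ} → inside b τ ≢ κ) → ∀ a {x y : V (suc k)} →
             Star Edge x y → Star (NotOfKind (suc k) κ) (cp a x) (cp a y)
  liftWalk inside≢κ a =
    mapWalk (cp a) (λ {u} {v} e → lift a e , λ κ′ → inside≢κ (trans (sym (kind-lift a u v)) κ′))

  mutual
    fromSource : ∀ k (y : V (suc k)) → Star (NotOfKind k backward) (source k) y
    fromSource zero    (w a)    = upTo w a (λ i _ → forward⇒notBackward (fwdArc i))
    fromSource (suc k) src      = ε
    fromSource (suc k) snk      = mapStar forward⇒notBackward (forwardSpine (suc k))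
    fromSource (suc k) (cp a z) =
      (arc-pu k , λ ())
      ◅ (upTo (entry k) a (λ i _ → forward⇒notBackward (entryArc k i))
         ◅◅ liftWalk (λ ()) a (connected k (source k) z))

    toSink : ∀ k (x : V (suc k)) → Star (NotOfKind k backward) x (sink k)
    toSink zero    (w a)    = upFrom w a (λ i _ → forward⇒notBackward (fwdArc i))
    toSink (suc k) src      = mapStar forward⇒notBackward (forwardSpine (suc k))
    toSink (suc k) snk      = ε
    toSink (suc k) (cp a z) =
      liftWalk (λ ()) a (connected k z (source k))
      ◅◅ (upFrom (entry k) a (λ i _ → forward⇒notBackward (entryArc k i)) ◅◅ ((arc-uq k , λ ()) ◅ ε))

    fromSink : ∀ k (y : V (suc k)) → Star (NotOfKind k forward) (sink k) y
    fromSink zero    (w a)    = downFrom w a (λ i _ → backward⇒notForward (bwdArc i))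
    fromSink (suc k) src      = mapStar backward⇒notForward (backwardSpine (suc k))
    fromSink (suc k) snk      = ε
    fromSink (suc k) (cp a z) =
      (arc-qv k , λ ())
      ◅ (downFrom (exit k) a (λ i _ → backward⇒notForward (exitArc k i))
         ◅◅ liftWalk (λ ()) a (connected k (sink k) z))

    toSource : ∀ k (x : V (suc k)) → Star (NotOfKind k forward) x (source k)
    toSource zero    (w a)    = downTo w a (λ i _ → backward⇒notForward (bwdArc i))
    toSource (suc k) src      = ε
    toSource (suc k) snk      = mapStar backward⇒notForward (backwardSpine (suc k))
    toSource (suc k) (cp a z) =
      liftWalk (λ ()) a (connected k z (sink k))
      ◅◅ (downTo (exit k) a (λ i _ → backward⇒notForward (exitArc k i)) ◅◅ ((arc-vp k , λ ()) ◅ ε))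

    connected : ∀ k (x y : V (suc k)) → Star Edge x y
    connected k x y = mapStar proj₁ (toSource k x) ◅◅ mapStar proj₁ (fromSource k y)

  -- Arcs of G_k whose tag is not τ: exactly the arcs of G_k − E(cycle τ).
  TagAvoiding : ∀ {k} → Tag k → V k → V k → Set
  TagAvoiding τ u v = Edge u v × tag u v ≢ τ

  avoiding⇒reach : ∀ {k} {τ : Tag k} {x y} → Star (TagAvoiding τ) x y → Reach (cycle τ) x y
  avoiding⇒reach {τ = τ} p = walk⇒reach (mapStar (λ (e , τ≢) → e , λ m → τ≢ (tagged τ m)) p)

  reach-invariant : ∀ {k} {τ : Tag k} (P : V k → Set) →
                    (∀ {u v} → TagAvoiding τ u v → P u → P v) →
                    ∀ {x y} → Reach (cycle τ) x y → P x → P y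
  reach-invariant P preserved here          px = px
  reach-invariant P preserved (step {u} {v} e ∉C p) px =
    reach-invariant P preserved p
      (preserved (e , λ eq → ∉C (subst (λ σ → (u , v) ∈ E (cycle σ)) eq (onOwnCycle e))) px)

  fin≢ : ∀ {n} {i j : Fin n} → toℕ i ≢ toℕ j → i ≢ j
  fin≢ toℕ≢ eq = toℕ≢ (cong toℕ eq)

  -- Removing the 2-cycle w_i ⇄ w_{i+1} splits G_1 into {w_0 … w_i} and {w_{i+1} … w_{R+1}}.
  module TwoCycleSeparates (i : Fin (suc R)) where

    Below : V 1 → Set
    Below (w a) = toℕ a ≤ toℕ i

    below-closed : ∀ {u v} → TagAvoiding i u v → Below u → Below v
    below-closed (fwd j , j≢i) j≤i =
      ℕP.≤∧≢⇒< (subst (_≤ toℕ i) (toℕ-inject₁ j) j≤i) (λ eq → j≢i (trans (lowerEnd-up j) (toℕ-injective eq)))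
    below-closed (bwd j , _)   j<i = subst (_≤ toℕ i) (sym (toℕ-inject₁ j)) (ℕP.<⇒≤ j<i)

    fwd-avoiding : ∀ j → toℕ j ≢ toℕ i → TagAvoiding i (w (inject₁ j)) (w (fsuc j))
    fwd-avoiding j j≢i = fwd j , λ eq → fin≢ j≢i (trans (sym (lowerEnd-up j)) eq)

    bwd-avoiding : ∀ j → toℕ j ≢ toℕ i → TagAvoiding i (w (fsuc j)) (w (inject₁ j))
    bwd-avoiding j j≢i = bwd j , λ eq → fin≢ j≢i (trans (sym (lowerEnd-down j)) eq)

    -- w_a goes back and forth to w_0 or to w_{R+1} along the path, avoiding the pair {w_i, w_{i+1}}.
    classify : ∀ v → SameSCC (cycle i) v (w fzero) ⊎ SameSCC (cycle i) v (w (fromℕ (suc R)))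
    classify (w a) with toℕ a ℕP.≤? toℕ i
    ... | yes a≤i =
      inj₁ (avoiding⇒reach (downTo w a (λ j j<a → bwd-avoiding j (ℕP.<⇒≢ (ℕP.<-≤-trans j<a a≤i)))) ,
            avoiding⇒reach (upTo w a (λ j j<a → fwd-avoiding j (ℕP.<⇒≢ (ℕP.<-≤-trans j<a a≤i)))))
    ... | no a≰i =
      let i<a = ℕP.≰⇒> a≰i in
      inj₂ (avoiding⇒reach (upFrom w a (λ j a≤j → fwd-avoiding j (ℕP.>⇒≢ (ℕP.<-≤-trans i<a a≤j)))) ,
            avoiding⇒reach (downFrom w a (λ j a≤j → bwd-avoiding j (ℕP.>⇒≢ (ℕP.<-≤-trans i<a a≤j)))))

    separates : TwoSCCs (cycle i) (w fzero) (w (fromℕ (suc R)))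
    separates =
      (λ (p→q , _) → ℕP.<⇒≱ (subst (toℕ i <_) (sym (toℕ-fromℕ (suc R))) (toℕ<n i))
                             (reach-invariant Below below-closed p→q z≤n)) ,
      classify

  -- Removing top cycle t splits G_{k+2} into the part left of it (p and the
  -- copies 0 … t−1) and the part right of it (q and the copies t … R−1).
  module TopCycleSeparates (k : ℕ) (t : Fin (suc R)) where

    τ : Tag (suc (suc k))
    τ = inj₁ t

    topTag≢ : ∀ {s : Fin (suc R)} → toℕ s ≢ toℕ t → _≢_ {A = Tag (suc (suc k))} (inj₁ s) τ
    topTag≢ s≢t refl = s≢t refl

    Left : V (suc (suc k)) → Set
    Left src      = ⊤
    Left snk      = ⊥
    Left (cp a _) = toℕ a < toℕ t

    left-closed : ∀ {u v} → TagAvoiding τ u v → Left u → Left v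
    left-closed (p→u i h , τ≢) _   =
      subst (_< toℕ t) (sym h) (ℕP.n≢0⇒n>0 (λ t≡0 → τ≢ (cong inj₁ (toℕ-injective (sym t≡0)))))
    left-closed (u→u i j h , τ≢) i<t =
      subst (_< toℕ t) h (ℕP.≤∧≢⇒< i<t
        (λ eq → τ≢ (trans (tag-ascending i j (source k) (source k) (ℕP.≤-reflexive h))
                          (cong inj₁ (toℕ-injective eq)))))
    left-closed (u→q i h , τ≢) i<t =
      τ≢ (cong inj₁ (toℕ-injective (trans (toℕ-fromℕ R) (sym t≡R))))
      where
      t≡R : toℕ t ≡ R
      t≡R = ℕP.≤-antisym (ℕP.<⇒≤pred (toℕ<n t)) (subst (_≤ toℕ t) h i<t)
    left-closed (v→v i j h , _) j<t = ℕP.<-trans (subst (toℕ i <_) h ℕP.≤-refl) j<t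
    left-closed (v→p i h , _) _     = tt
    left-closed (lift a e , _) a<t  = a<t

    -- Walks of copy a carried into G_{k+2} avoid top cycle t when their kind
    -- avoids the spine of copy a lying on it.
    liftBelow : ∀ a → toℕ a < toℕ t → ∀ {x y} → Star (NotOfKind k backward) x y →
                Star (TagAvoiding τ) (cp a x) (cp a y)
    liftBelow a a<t = mapWalk (cp a) λ {x} {y} (e , κ≢) →
      lift a e , λ eq → avoids (kind x y) κ≢ (trans (sym (tag-lift a x y)) eq)
      where
      avoids : ∀ κ → κ ≢ backward → kindTag a κ ≢ τ
      avoids forward      _   = topTag≢ (λ eq → ℕP.<-irrefl (trans (sym (toℕ-inject₁ a)) eq) a<t)
      avoids backward     κ≢  = ⊥-elim (κ≢ refl)
      avoids (inside _ _) _ ()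

    liftAbove : ∀ a → toℕ t ≤ toℕ a → ∀ {x y} → Star (NotOfKind k forward) x y →
                Star (TagAvoiding τ) (cp a x) (cp a y)
    liftAbove a t≤a = mapWalk (cp a) λ {x} {y} (e , κ≢) →
      lift a e , λ eq → avoids (kind x y) κ≢ (trans (sym (tag-lift a x y)) eq)
      where
      avoids : ∀ κ → κ ≢ forward → kindTag a κ ≢ τ
      avoids forward      κ≢  = ⊥-elim (κ≢ refl)
      avoids backward     _   = topTag≢ (λ eq → ℕP.<-irrefl (sym eq) (s≤s t≤a))
      avoids (inside _ _) _ ()

    -- The chain arcs u_i → u_{i+1} and v_{i+1} → v_i lie on top cycle i+1.
    chain≢ : ∀ (i : Fin r') → suc (toℕ i) ≢ toℕ t → _≢_ {A = Tag (suc (suc k))} (inj₁ (fsuc (inject₁ i))) τ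
    chain≢ i i+1≢t = topTag≢ (λ eq → i+1≢t (trans (cong suc (sym (toℕ-inject₁ i))) eq))

    entryAvoiding : ∀ i → suc (toℕ i) ≢ toℕ t → TagAvoiding τ (entry k (inject₁ i)) (entry k (fsuc i))
    entryAvoiding i i+1≢t = arc-uu k i , λ eq →
      chain≢ i i+1≢t (trans (sym (tag-ascending (inject₁ i) (fsuc i) (source k) (source k) (inject₁<suc i))) eq)

    exitAvoiding : ∀ i → suc (toℕ i) ≢ toℕ t → TagAvoiding τ (exit k (fsuc i)) (exit k (inject₁ i))
    exitAvoiding i i+1≢t = arc-vv k i , λ eq →
      chain≢ i i+1≢t (trans (sym (tag-descending (inject₁ i) (fsuc i) (sink k) (sink k) (inject₁<suc i))) eq)

    -- A vertex in a copy left of t reaches p through its copy's sink and the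
    -- v-chain, and is reached from p through the u-chain and its copy's source.
    module LeftCopy (a : Fin R) (a<t : toℕ a < toℕ t) where

      before : ∀ {n} → n ≤ toℕ a → n ≢ toℕ t
      before n≤a = ℕP.<⇒≢ (ℕP.≤-<-trans n≤a a<t)

      p≢ : _≢_ {A = Tag (suc (suc k))} (inj₁ fzero) τ
      p≢ = topTag≢ (before z≤n)

      toSrc : ∀ z → Star (TagAvoiding τ) (cp a z) src
      toSrc z = liftBelow a a<t (toSink k z)
                ◅◅ (downTo (exit k) a (λ i i<a → exitAvoiding i (before i<a)) ◅◅ ((arc-vp k , p≢) ◅ ε))

      fromSrc : ∀ z → Star (TagAvoiding τ) src (cp a z)
      fromSrc z = (arc-pu k , p≢)
                  ◅ (upTo (entry k) a (λ i i<a → entryAvoiding i (before i<a)) ◅◅ liftBelow a a<t (fromSource k z))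

    -- Symmetrically for a copy right of t, through q.
    module RightCopy (a : Fin R) (t≤a : toℕ t ≤ toℕ a) where

      after : ∀ {n} → suc (toℕ a) ≤ n → n ≢ toℕ t
      after a<n = ℕP.>⇒≢ (ℕP.<-≤-trans (s≤s t≤a) a<n)

      q≢ : _≢_ {A = Tag (suc (suc k))} (inj₁ (fromℕ R)) τ
      q≢ = topTag≢ (after (subst (suc (toℕ a) ≤_) (sym (toℕ-fromℕ R)) (toℕ<n a)))

      toSnk : ∀ z → Star (TagAvoiding τ) (cp a z) snk
      toSnk z = liftAbove a t≤a (toSource k z)
                ◅◅ (upFrom (entry k) a (λ i a≤i → entryAvoiding i (after (s≤s a≤i))) ◅◅ ((arc-uq k , q≢) ◅ ε))

      fromSnk : ∀ z → Star (TagAvoiding τ) snk (cp a z)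
      fromSnk z = (arc-qv k , q≢)
                  ◅ (downFrom (exit k) a (λ i a≤i → exitAvoiding i (after (s≤s a≤i))) ◅◅ liftAbove a t≤a (fromSink k z))

    classify : ∀ v → SameSCC (cycle τ) v src ⊎ SameSCC (cycle τ) v snk
    classify src = inj₁ (here , here)
    classify snk = inj₂ (here , here)
    classify (cp a z) with toℕ a ℕP.<? toℕ t
    ... | yes a<t = inj₁ (avoiding⇒reach (LeftCopy.toSrc a a<t z) , avoiding⇒reach (LeftCopy.fromSrc a a<t z))
    ... | no a≮t  = let t≤a = ℕP.≮⇒≥ a≮t in
                    inj₂ (avoiding⇒reach (RightCopy.toSnk a t≤a z) , avoiding⇒reach (RightCopy.fromSnk a t≤a z))

    separates : TwoSCCs (cycle τ) src snk
    separates = (λ (p→q , _) → reach-invariant Left left-closed p→q tt) , classify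

  TerminalLinked : ∀ {k} → Dicycle R (suc k) → Set
  TerminalLinked {k} C = ∀ v → (Reach C v (source k) ⊎ Reach C v (sink k))
                             × (Reach C (source k) v ⊎ Reach C (sink k) v)

  connected⇒linked : ∀ {k} (C : Dicycle R (suc k)) → StronglyConnectedMinus C → TerminalLinked C
  connected⇒linked {k} C connected v = inj₁ (connected v (source k)) , inj₁ (connected (source k) v)

  good⇒linked : ∀ {k} (C : Dicycle R (suc k)) → GoodCycle (source k) (sink k) C → TerminalLinked C
  good⇒linked C (inj₁ (_ , _ , classify)) v with classify v
  ... | inj₁ (to , from) = inj₁ to , inj₁ from
  ... | inj₂ (to , from) = inj₂ to , inj₂ from
  good⇒linked C (inj₂ (_ , connected)) = connected⇒linked C connected

  -- Copying a terminal-linked cycle C of G_{k+1} into copy b of G_{k+2} gives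
  -- a cycle D with G_{k+2} − E(D) strongly connected: every vertex reaches p
  -- and is reached from p, through the chains of E_{k+2}, the other copies
  -- (untouched by D), and the terminals of copy b.
  module CopyConnected (k : ℕ) (b : Fin R) (C : Dicycle R (suc k)) (linked : TerminalLinked C) where

    D : Dicycle R (suc (suc k))
    D = liftCycle b C

    avoidsD : ∀ {u v} → (∀ {x y} → _≡_ {A = V (suc (suc k)) × V (suc (suc k))} (u , v) (cp b x , cp b y) → ⊥) →
              ¬ ((u , v) ∈ E D)
    avoidsD outside m with ∈-liftCycle⁻ b C m
    ... | _ , _ , refl , refl = outside refl

    betweenCopies : ∀ {a a′} {x y x′ y′ : V (suc k)} → a ≢ a′ →
                    _≡_ {A = V (suc (suc k)) × V (suc (suc k))} (cp a x , cp a′ y) (cp b x′ , cp b y′) → ⊥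
    betweenCopies a≢a′ refl = a≢a′ refl

    otherCopy : ∀ {a} → a ≢ b → ∀ {x y : V (suc k)} → Star Edge x y → Star (Avoiding D) (cp a x) (cp a y)
    otherCopy a≢b = mapWalk (cp _) (λ e → lift _ e , avoidsD (λ eq → a≢b (cp-index (cong proj₁ eq))))

    inCopy : ∀ {x y} → Reach C x y → Star (Avoiding D) (cp b x) (cp b y)
    inCopy p = mapWalk (cp b) liftAvoiding (reach⇒walk p)
      where
      liftAvoiding : ∀ {x y} → Avoiding C x y → Avoiding D (cp b x) (cp b y)
      liftAvoiding (e , ∉C) = lift b e , λ m → ∉C (reflect (∈-liftCycle⁻ b C m))
        where
        reflect : ∀ {x y} → Σ _ (λ (x′ , y′) → (x′ , y′) ∈ E C × cp b x ≡ cp b x′ × cp b y ≡ cp b y′) →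
                  (x , y) ∈ E C
        reflect (_ , m′ , refl , refl) = m′

    exitsToSource : ∀ a → Star (Avoiding D) (exit k a) src
    exitsToSource a = downTo (exit k) a (λ i _ → arc-vv k i , avoidsD (betweenCopies (λ eq → inject₁≢suc i (sym eq))))
                      ◅◅ ((arc-vp k , avoidsD (λ ())) ◅ ε)

    entriesToSink : ∀ a → Star (Avoiding D) (entry k a) snk
    entriesToSink a = upFrom (entry k) a (λ i _ → arc-uu k i , avoidsD (betweenCopies (inject₁≢suc i)))
                      ◅◅ ((arc-uq k , avoidsD (λ ())) ◅ ε)

    sourceToEntries : ∀ a → Star (Avoiding D) src (entry k a)
    sourceToEntries a = (arc-pu k , avoidsD (λ ()))
                        ◅ upTo (entry k) a (λ i _ → arc-uu k i , avoidsD (betweenCopies (inject₁≢suc i)))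

    sinkToExits : ∀ a → Star (Avoiding D) snk (exit k a)
    sinkToExits a = (arc-qv k , avoidsD (λ ()))
                    ◅ downFrom (exit k) a (λ i _ → arc-vv k i , avoidsD (betweenCopies (λ eq → inject₁≢suc i (sym eq))))

    toSrc : ∀ x → Star (Avoiding D) x src
    toSrc src = ε
    toSrc snk = sinkToExits fzero ◅◅ exitsToSource fzero
    toSrc (cp a z) with a ≟ b
    ... | no a≢b = otherCopy a≢b (connected k z (sink k)) ◅◅ exitsToSource a
    ... | yes refl with proj₁ (linked z)
    ...   | inj₁ z→p = inCopy z→p ◅◅ (entriesToSink b ◅◅ toSrc snk)
    ...   | inj₂ z→q = inCopy z→q ◅◅ exitsToSource b

    fromSrc : ∀ y → Star (Avoiding D) src y
    fromSrc src = ε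
    fromSrc snk = sourceToEntries fzero ◅◅ entriesToSink fzero
    fromSrc (cp a z) with a ≟ b
    ... | no a≢b = sourceToEntries a ◅◅ otherCopy a≢b (connected k (source k) z)
    ... | yes refl with proj₂ (linked z)
    ...   | inj₁ p→z = sourceToEntries b ◅◅ inCopy p→z
    ...   | inj₂ q→z = (fromSrc snk ◅◅ sinkToExits b) ◅◅ inCopy q→z

    stronglyConnected : StronglyConnectedMinus D
    stronglyConnected x y = walk⇒reach (toSrc x ◅◅ fromSrc y)

  taggedCycle-external : ∀ {k τ} (W : TaggedCycle k τ) → AllExternal (taggedDicycle W)
  taggedCycle-external W = All.map proj₁ (taggedCycle-arcs W)

  liftTwice-internal : ∀ {k} a b (C : Dicycle R (suc k)) → AllInternal (liftCycle a (liftCycle b C))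
  liftTwice-internal a b C = All.tabulate internal
    where
    internal : ∀ {uv} → uv ∈ E (liftCycle a (liftCycle b C)) → Σ (Edge (proj₁ uv) (proj₂ uv)) Internal
    internal m with ∈-liftCycle⁻ a (liftCycle b C) m
    ... | _ , m′ , refl , refl with ∈-liftCycle⁻ b C m′
    ... | _ , m″ , refl , refl = lift a (lift b (All.lookup (arcs C) m″)) , λ ()

  cycle-good : ∀ k (τ : Tag (suc k)) → GoodCycle (source k) (sink k) (cycle τ)
  cycle-good zero    i        = inj₁ (taggedCycle-external (twoCycle i) , TwoCycleSeparates.separates i)
  cycle-good (suc k) (inj₁ t) = inj₁ (taggedCycle-external (topCycle k t) , TopCycleSeparates.separates k t)
  cycle-good (suc (suc k)) (inj₂ (a , b , τ)) =
    inj₂ (liftTwice-internal a b (cycle τ) ,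
          CopyConnected.stronglyConnected (suc k) a inner (connected⇒linked inner innerConnected))
    where
    inner : Dicycle R (suc (suc k))
    inner = liftCycle b (cycle τ)
    innerConnected : StronglyConnectedMinus inner
    innerConnected = CopyConnected.stronglyConnected k b (cycle τ) (good⇒linked (cycle τ) (cycle-good k τ))

lemma4 : (r : ℕ) → 1 ≤ r → (k : ℕ) → 1 ≤ k → HasGoodDecomposition r k
lemma4 (suc r') _ (suc k) _ =
  tagCount (suc k) , decomposition (suc k) , decomposition-partition (suc k) ,
  λ i → cycle-good k (Inverse.to (enumerateTags (suc k)) i)
  where open Construction r'
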